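{- Let $G$ be a connected graph of order $n\geq 4$ and let $k$ be an integer with $3\leq k\leq n$. Then $px_k(G)=n-1$ if and only if $G$ is isomorphic to the star $S_n$ (the tree on $n$ vertices with a vertex of degree $n-1$).
   Context: All graphs are finite, simple, undirected and connected. An edge-coloring of a graph $G$ assigns colors to edges (adjacent edges may receive the same color). A tree in an edge-colored graph is a proper tree if any two adjacent edges of it receive different colors. For $S\subseteq V(G)$, an $S$-tree is a tree in $G$ containing all vertices of $S$. For a graph $G$ of order $n$ and an integer $k$ with $2\leq k\leq n$, an edge-coloring of $G$ is a $k$-proper coloring if for every set $S$ of $k$ vertices of $G$ there is a proper $S$-tree in $G$. The $k$-proper index $px_k(G)$ of a nontrivial connected graph $G$ is the smallest number of colors in a $k$-proper coloring of $G$. -}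

module Defs where

open import Data.Nat using (ℕ; zero; suc; _+_; _∸_; _<_)
open import Data.Fin using (Fin; zero; suc; inject₁; fromℕ)
open import Data.Fin.Subset using (Subset; _∈_; _⊆_; ∣_∣)
open import Data.Bool using (Bool; true; false; _xor_)
open import Data.Product using (Σ; ∃; _×_)
open import Relation.Binary.PropositionalEquality using (_≡_; _≢_)
open import Function.Definitions using (Injective)
open import Function.Bundles using (_↔_; Inverse)
open import Relation.Nullary using (¬_)

record Graph (n : ℕ) : Set where
  field
    adj     : Fin n → Fin n → Bool
    adj-sym : ∀ u v → adj u v ≡ adj v u
    irrefl  : ∀ u → adj u u ≡ false
open Graph public

data Walk {n : ℕ} (R : Fin n → Fin n → Bool) : Fin n → Fin n → Set where
  here  : ∀ {u} → Walk R u u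
  step  : ∀ {u v w} → R u v ≡ true → Walk R v w → Walk R u w

Connected : ∀ {n} → Graph n → Set
Connected {n} G = ∀ (u v : Fin n) → Walk (adj G) u v

-- A cycle of length m+3 in the relation R: distinct vertices c 0 … c (m+2),
-- consecutive ones related, and c (m+2) related to c 0.
Cycle : ∀ {n} → (Fin n → Fin n → Bool) → Set
Cycle {n} R = Σ ℕ λ m → Σ (Fin (suc (suc (suc m))) → Fin n) λ c →
  Injective _≡_ _≡_ c ×
  (∀ (i : Fin (suc (suc m))) → R (c (inject₁ i)) (c (suc i)) ≡ true) ×
  (R (c (fromℕ (suc (suc m)))) (c zero) ≡ true)

record SubTree {n : ℕ} (G : Graph n) : Set where
  field
    V       : Subset n
    E       : Fin n → Fin n → Bool
    E-sym   : ∀ u v → E u v ≡ E v u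
    E-irr   : ∀ u → E u u ≡ false
    E-sub   : ∀ u v → E u v ≡ true → adj G u v ≡ true
    E-inV   : ∀ u v → E u v ≡ true → u ∈ V
    conn    : ∀ u v → u ∈ V → v ∈ V → Walk E u v
    acyclic : ¬ Cycle E
open SubTree public

-- An edge-colouring of G with (at most) m colours: a symmetric colour function
-- (only its values on edges matter).
record Colouring {n : ℕ} (G : Graph n) (m : ℕ) : Set where
  field
    col     : Fin n → Fin n → Fin m
    col-sym : ∀ u v → col u v ≡ col v u
open Colouring public

ProperTree : ∀ {n m} {G : Graph n} → Colouring G m → SubTree G → Set
ProperTree {n} c T = ∀ (u v w : Fin n) → E T u v ≡ true → E T u w ≡ true →
  v ≢ w → col c u v ≢ col c u w

KProper : ∀ {n m} {G : Graph n} → ℕ → Colouring G m → Set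
KProper {n} {m} {G} k c = ∀ (S : Subset n) → ∣ S ∣ ≡ k →
  Σ (SubTree G) λ T → (S ⊆ V T) × ProperTree c T

PxIs : ∀ {n} → Graph n → ℕ → ℕ → Set
PxIs G k p = Σ (Colouring G p) (KProper k) ×
  (∀ q → q < p → (c : Colouring G q) → ¬ KProper k c)

starAdj : ∀ {n} → Fin n → Fin n → Bool
starAdj zero    zero    = false
starAdj zero    (suc _) = true
starAdj (suc _) zero    = true
starAdj (suc _) (suc _) = false

IsoToStar : ∀ {n} → Graph n → Set
IsoToStar {n} G = Σ (Fin n ↔ Fin n) λ f →
  ∀ u v → adj G u v ≡ starAdj (Inverse.to f u) (Inverse.to f v)

-- Colouring each edge of a rooted spanning tree by its lower endpoint makes the tree
-- proper, so n - 1 colours always suffice, and the tree serves every vertex set. For the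
-- star this is optimal: two leaves whose edges to the centre share a colour lie in no
-- common proper tree, since a tree through a leaf must use its only edge.
-- A connected graph on at least four vertices that is not a star contains a path
-- a b c d (a triangle, or a vertex of degree one, would force a star). In a spanning
-- tree rooted at b that contains this path, the parent edges ab and cd are disjoint,
-- so a and d may share a colour and n - 2 colours already give a proper spanning tree.

module Submission where

open import Defs
open import Data.Nat using (ℕ; zero; suc; _≤_; _<_; _∸_; _+_; z≤n; s≤s; _≤?_)
open import Data.Nat.Properties
  using ( ≤-refl; ≤-trans; <-irrefl; <-trans; ≤-<-trans; <-≤-trans; ≤-pred; ≮⇒≥; ≰⇒>; ≤-total
        ; ≤-antisym; +-suc; n≤1+n; m≤n⇒m≤1+n; m≤m+n; +-monoʳ-<; module ≤-Reasoning)
open import Data.Fin using (Fin; zero; suc; inject₁; fromℕ; punchIn; punchOut; _≟_)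
open import Data.Fin.Patterns using (0F; 1F; 2F; 3F)
open import Data.Fin.Properties
  using (any?; pigeonhole; punchIn-injective; punchInᵢ≢i; punchOut-injective; <⇒notInjective; <⇒≢; suc-injective)
open import Data.Fin.Subset using (Subset; _∈_; _⊆_; ∣_∣; ⁅_⁆; _∪_; ⊤)
open import Data.Fin.Subset.Properties using (∈⊤; ∣⊤∣≡n; s⊆s; x∈⁅x⁆; ∣⁅x⁆∣≡1; x∈p∪q⁺)
open import Data.Fin.Permutation using (transpose)
import Data.Fin.Permutation.Components as PC
open import Data.Vec using ([]; _∷_)
open import Data.Bool using (Bool; true; false; if_then_else_) renaming (_≟_ to _≟ᵇ_)
open import Data.Bool.Properties using (∨-comm)
open import Data.Product using (∃; ∃₂; _×_; _,_; proj₁; proj₂)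
open import Data.Sum using (_⊎_; inj₁; inj₂)
open import Data.Empty using (⊥; ⊥-elim)
open import Function using (_∘_)
open import Function.Bundles using (_⇔_; mk⇔; _↔_; Inverse; Equivalence)
open import Function.Definitions using (Injective)
open import Relation.Nullary using (¬_; Dec; yes; no; does; contradiction)
open import Relation.Nullary.Decidable using (dec-true; dec-false; ¬?; _×-dec_; _⊎-dec_)
open import Relation.Nullary.Decidable.Core using (decidable-stable)
open import Relation.Unary using (Pred; Decidable)
open import Relation.Binary.PropositionalEquality using (_≡_; _≢_; refl; sym; trans; cong; cong₂; subst)

witness : ∀ {a} {A : Set a} (a? : Dec A) → does a? ≡ true → A
witness (yes a) _ = a

least : ∀ {P : ℕ → Set} → Decidable P → ∀ {i} → P i →
  ∃ λ j → P j × (∀ {k} → k < j → ¬ P k)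
least P? {zero} p = zero , p , λ ()
least P? {suc i} p with P? zero
... | yes p₀ = zero , p₀ , λ ()
... | no ¬p₀ with least (P? ∘ suc) p
...   | j , pj , below = suc j , pj , λ { {zero} _ → ¬p₀ ; {suc k} (s≤s k<j) → below k<j }

argmax : ∀ {k} (f : Fin (suc k) → ℕ) → ∃ λ i → ∀ j → f j ≤ f i
argmax {zero} f = zero , λ { zero → ≤-refl }
argmax {suc k} f with argmax (f ∘ suc)
... | i , max with ≤-total (f zero) (f (suc i))
...   | inj₁ f₀≤ = suc i , λ { zero → f₀≤ ; (suc j) → max j }
...   | inj₂ ≤f₀ = zero , λ { zero → ≤-refl ; (suc j) → ≤-trans (max j) ≤f₀ }

data LastOrInject₁ {k : ℕ} : Fin (suc k) → Set where
  last   : LastOrInject₁ (fromℕ k)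
  inject : (j : Fin k) → LastOrInject₁ (inject₁ j)

lastOrInject₁ : ∀ {k} (i : Fin (suc k)) → LastOrInject₁ i
lastOrInject₁ {zero}  zero    = last
lastOrInject₁ {suc k} zero    = inject zero
lastOrInject₁ {suc k} (suc i) with lastOrInject₁ i
... | last     = last
... | inject j = inject (suc j)

inject₁²≢suc² : ∀ {k} (j : Fin k) → inject₁ (inject₁ j) ≢ suc (suc j)
inject₁²≢suc² zero    ()
inject₁²≢suc² (suc j) eq = inject₁²≢suc² j (suc-injective eq)

avoid-three : ∀ {n} → 3 < n → (a b c : Fin n) → ∃ λ t → t ≢ a × t ≢ b × t ≢ c
avoid-three {n} 3<n a b c with any? (λ t → ¬? (t ≟ a) ×-dec ¬? (t ≟ b) ×-dec ¬? (t ≟ c))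
... | yes found = found
... | no none = ⊥-elim (<⇒notInjective 3<n which-injective)
  where
  which : Fin n → Fin 3
  which t with t ≟ a | t ≟ b
  ... | yes _ | _     = zero
  ... | no _  | yes _ = suc zero
  ... | no _  | no _  = suc (suc zero)
  pick : Fin 3 → Fin n
  pick zero             = a
  pick (suc zero)       = b
  pick (suc (suc zero)) = c
  pick-which : ∀ t → pick (which t) ≡ t
  pick-which t with t ≟ a | t ≟ b
  ... | yes t≡a | _      = sym t≡a
  ... | no _    | yes t≡b = sym t≡b
  ... | no t≢a  | no t≢b with t ≟ c
  ...   | yes t≡c = sym t≡c
  ...   | no t≢c  = ⊥-elim (none (t , t≢a , t≢b , t≢c))
  which-injective : Injective _≡_ _≡_ which
  which-injective {s} {t} eq = trans (sym (pick-which s)) (trans (cong pick eq) (pick-which t))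

-- The value at the root itself is arbitrary.
withoutRoot : ∀ {k} → Fin (suc (suc k)) → Fin (suc (suc k)) → Fin (suc k)
withoutRoot r v with r ≟ v
... | yes _   = zero
... | no r≢v = punchOut r≢v

withoutRoot-injective : ∀ {k} {r x y : Fin (suc (suc k))} → x ≢ r → y ≢ r →
  withoutRoot r x ≡ withoutRoot r y → x ≡ y
withoutRoot-injective {r = r} {x} {y} x≢r y≢r eq with r ≟ x | r ≟ y
... | yes r≡x | _       = ⊥-elim (x≢r (sym r≡x))
... | no _    | yes r≡y = ⊥-elim (y≢r (sym r≡y))
... | no r≢x  | no r≢y  = punchOut-injective r≢x r≢y eq

merge : ∀ {m} {i j : Fin (suc m)} → i ≢ j → Fin (suc m) → Fin m
merge {j = j} i≢j x with j ≟ x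
... | yes _   = punchOut (i≢j ∘ sym)
... | no j≢x = punchOut j≢x

merge-identifies : ∀ {m} {i j x y : Fin (suc m)} (i≢j : i ≢ j) → merge i≢j x ≡ merge i≢j y →
  x ≡ y ⊎ (x ≡ i × y ≡ j) ⊎ (x ≡ j × y ≡ i)
merge-identifies {j = j} {x} {y} i≢j eq with j ≟ x | j ≟ y
... | yes j≡x | yes j≡y = inj₁ (trans (sym j≡x) j≡y)
... | yes j≡x | no j≢y  = inj₂ (inj₂ (sym j≡x , sym (punchOut-injective (i≢j ∘ sym) j≢y eq)))
... | no j≢x  | yes j≡y = inj₂ (inj₁ (punchOut-injective j≢x (i≢j ∘ sym) eq , sym j≡y))
... | no j≢x  | no j≢y  = inj₁ (punchOut-injective j≢x j≢y eq)

∣p∪q∣≤∣p∣+∣q∣ : ∀ {n} (p q : Subset n) → ∣ p ∪ q ∣ ≤ ∣ p ∣ + ∣ q ∣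
∣p∪q∣≤∣p∣+∣q∣ []          []          = z≤n
∣p∪q∣≤∣p∣+∣q∣ (true ∷ p)  (true ∷ q)  rewrite +-suc ∣ p ∣ ∣ q ∣ = s≤s (m≤n⇒m≤1+n (∣p∪q∣≤∣p∣+∣q∣ p q))
∣p∪q∣≤∣p∣+∣q∣ (true ∷ p)  (false ∷ q) = s≤s (∣p∪q∣≤∣p∣+∣q∣ p q)
∣p∪q∣≤∣p∣+∣q∣ (false ∷ p) (true ∷ q)  rewrite +-suc ∣ p ∣ ∣ q ∣ = s≤s (∣p∪q∣≤∣p∣+∣q∣ p q)
∣p∪q∣≤∣p∣+∣q∣ (false ∷ p) (false ∷ q) = ∣p∪q∣≤∣p∣+∣q∣ p q

extend-to-size : ∀ {n} (S : Subset n) {k} → ∣ S ∣ ≤ k → k ≤ n → ∃ λ S′ → S ⊆ S′ × ∣ S′ ∣ ≡ k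
extend-to-size [] {zero} _ _ = [] , (λ ()) , refl
extend-to-size (true ∷ S) {suc k} (s≤s S≤k) (s≤s k≤n) with extend-to-size S S≤k k≤n
... | S′ , S⊆S′ , size = true ∷ S′ , s⊆s S⊆S′ , cong suc size
extend-to-size {suc n} (false ∷ S) {k} S≤k k≤1+n with k ≤? n
... | yes k≤n with extend-to-size S S≤k k≤n
...   | S′ , S⊆S′ , size = false ∷ S′ , s⊆s S⊆S′ , size
extend-to-size {suc n} (false ∷ S) {k} S≤k k≤1+n | no k≰n =
  ⊤ , (λ _ → ∈⊤) , trans (∣⊤∣≡n (suc n)) (≤-antisym (≰⇒> k≰n) k≤1+n)

∣⁅x⁆∪⁅y⁆∣≤2 : ∀ {n} (x y : Fin n) → ∣ ⁅ x ⁆ ∪ ⁅ y ⁆ ∣ ≤ 2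
∣⁅x⁆∪⁅y⁆∣≤2 x y = begin
  ∣ ⁅ x ⁆ ∪ ⁅ y ⁆ ∣     ≤⟨ ∣p∪q∣≤∣p∣+∣q∣ ⁅ x ⁆ ⁅ y ⁆ ⟩
  ∣ ⁅ x ⁆ ∣ + ∣ ⁅ y ⁆ ∣ ≡⟨ cong₂ _+_ (∣⁅x⁆∣≡1 x) (∣⁅x⁆∣≡1 y) ⟩
  2                     ∎
  where open ≤-Reasoning

pair-in-subset-of-size : ∀ {n} (x y : Fin n) {k} → 2 ≤ k → k ≤ n →
  ∃ λ S → ∣ S ∣ ≡ k × x ∈ S × y ∈ S
pair-in-subset-of-size x y 2≤k k≤n with extend-to-size (⁅ x ⁆ ∪ ⁅ y ⁆) (≤-trans (∣⁅x⁆∪⁅y⁆∣≤2 x y) 2≤k) k≤n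
... | S , pair⊆S , size = S , size , pair⊆S (x∈p∪q⁺ (inj₁ (x∈⁅x⁆ x))) , pair⊆S (x∈p∪q⁺ (inj₂ (x∈⁅x⁆ y)))

_++ʷ_ : ∀ {n} {R : Fin n → Fin n → Bool} {u v w} → Walk R u v → Walk R v w → Walk R u w
here       ++ʷ q = q
step e p   ++ʷ q = step e (p ++ʷ q)

reverseʷ : ∀ {n} {R : Fin n → Fin n → Bool} → (∀ u v → R u v ≡ R v u) →
  ∀ {u v} → Walk R u v → Walk R v u
reverseʷ R-sym here                 = here
reverseʷ R-sym (step {u} {v} e p) = reverseʷ R-sym p ++ʷ step (trans (R-sym v u) e) here

walk-preserves : ∀ {n} {R : Fin n → Fin n → Bool} {p} (P : Pred (Fin n) p) →
  (∀ {x y} → P x → R x y ≡ true → P y) → ∀ {u v} → P u → Walk R u v → P v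
walk-preserves P closed pu here       = pu
walk-preserves P closed pu (step e w) = walk-preserves P closed (closed pu e) w

walk-first-step : ∀ {n} {R : Fin n → Fin n → Bool} {u v} → u ≢ v → Walk R u v → ∃ λ w → R u w ≡ true
walk-first-step u≢v here       = ⊥-elim (u≢v refl)
walk-first-step _   (step e _) = _ , e

cycle-neighbours : ∀ {n} {R : Fin n → Fin n → Bool} → (∀ u v → R u v ≡ R v u) →
  ∀ {m} (c : Fin (3 + m) → Fin n) →
  (∀ (i : Fin (2 + m)) → R (c (inject₁ i)) (c (suc i)) ≡ true) → R (c (fromℕ (2 + m))) (c zero) ≡ true →
  ∀ i → ∃₂ λ a b → a ≢ b × R (c i) (c a) ≡ true × R (c i) (c b) ≡ true
cycle-neighbours R-sym c consecutive closing zero =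
  suc zero , fromℕ _ , (λ ()) , consecutive zero , trans (R-sym _ _) closing
cycle-neighbours R-sym c consecutive closing (suc j) with lastOrInject₁ j
... | last     = inject₁ (fromℕ _) , zero , (λ ()) , trans (R-sym _ _) (consecutive (fromℕ _)) , closing
... | inject i = inject₁ (inject₁ i) , suc (suc i) , inject₁²≢suc² i ,
                 trans (R-sym _ _) (consecutive (inject₁ i)) , consecutive (suc i)

module DistanceTo {n} (G : Graph n) (connected : Connected G)
  {S : Fin n → Set} (S? : Decidable S) {s} (s∈S : S s) where

  Within : ℕ → Fin n → Set
  Within zero    = S
  Within (suc i) v = Within i v ⊎ ∃ λ u → adj G v u ≡ true × Within i u

  within? : ∀ i → Decidable (Within i)
  within? zero    = S?
  within? (suc i) v = within? i v ⊎-dec any? (λ u → (adj G v u ≟ᵇ true) ×-dec within? i u)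

  walk⇒within : ∀ {v} → Walk (adj G) v s → ∃ λ i → Within i v
  walk⇒within here = zero , s∈S
  walk⇒within (step e w) with walk⇒within w
  ... | i , within = suc i , inj₂ (_ , e , within)

  private
    least-within : ∀ v → ∃ λ j → Within j v × (∀ {k} → k < j → ¬ Within k v)
    least-within v = least (λ i → within? i v) (proj₂ (walk⇒within (connected v s)))

  distance : Fin n → ℕ
  distance v = proj₁ (least-within v)

  distance-minimal : ∀ {i v} → Within i v → distance v ≤ i
  distance-minimal {v = v} within = ≮⇒≥ λ i<d → proj₂ (proj₂ (least-within v)) i<d within

  closer-neighbour : ∀ v → ¬ S v → ∃ λ u → adj G v u ≡ true × distance u < distance v
  closer-neighbour v v∉S =
    from-level (distance v) (proj₁ (proj₂ (least-within v))) (proj₂ (proj₂ (least-within v)))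
    where
    from-level : ∀ j → Within j v → (∀ {k} → k < j → ¬ Within k v) →
      ∃ λ u → adj G v u ≡ true × distance u < j
    from-level zero    v∈S                    _     = ⊥-elim (v∉S v∈S)
    from-level (suc i) (inj₁ within)          below = ⊥-elim (below ≤-refl within)
    from-level (suc i) (inj₂ (u , e , within)) _    = u , e , s≤s (distance-minimal within)

record ParentTree {n} (G : Graph n) : Set where
  field
    root             : Fin n
    parent           : Fin n → Fin n
    depth            : Fin n → ℕ
    parent-shallower : ∀ {v} → v ≢ root → depth (parent v) < depth v
    parent-adjacent  : ∀ {v} → v ≢ root → adj G v (parent v) ≡ true

module _ {n} {G : Graph n} (T : ParentTree G) where
  open ParentTree T

  ChildOf : Fin n → Fin n → Set
  ChildOf u v = u ≢ root × parent u ≡ v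

  childOf? : ∀ u v → Dec (ChildOf u v)
  childOf? u v = ¬? (u ≟ root) ×-dec (parent u ≟ v)

  child-deeper : ∀ {u v} → ChildOf u v → depth v < depth u
  child-deeper (u≢root , refl) = parent-shallower u≢root

  child≢parent : ∀ {u v} → ChildOf u v → u ≢ v
  child≢parent c refl = <-irrefl refl (child-deeper c)

  TreeEdge : Fin n → Fin n → Set
  TreeEdge u v = ChildOf u v ⊎ ChildOf v u

  treeEdge? : ∀ u v → Dec (TreeEdge u v)
  treeEdge? u v = childOf? u v ⊎-dec childOf? v u

  treeAdj : Fin n → Fin n → Bool
  treeAdj u v = does (treeEdge? u v)

  treeAdj-sym : ∀ u v → treeAdj u v ≡ treeAdj v u
  treeAdj-sym u v = ∨-comm (does (childOf? u v)) (does (childOf? v u))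

  treeAdj-irrefl : ∀ u → treeAdj u u ≡ false
  treeAdj-irrefl u =
    dec-false (treeEdge? u u) λ { (inj₁ c) → child≢parent c refl ; (inj₂ c) → child≢parent c refl }

  treeAdj⇒adj : ∀ u v → treeAdj u v ≡ true → adj G u v ≡ true
  treeAdj⇒adj u v e with witness (treeEdge? u v) e
  ... | inj₁ (u≢root , refl) = parent-adjacent u≢root
  ... | inj₂ (v≢root , refl) = trans (adj-sym G u v) (parent-adjacent v≢root)

  walk-to-root : ∀ v → Walk treeAdj v root
  walk-to-root v = climb (suc (depth v)) v ≤-refl
    where
    climb : ∀ fuel v → depth v < fuel → Walk treeAdj v root
    climb (suc fuel) v d<fuel with v ≟ root
    ... | yes refl = here
    ... | no v≢root = step (dec-true (treeEdge? v (parent v)) (inj₁ (v≢root , refl)))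
                           (climb fuel (parent v) (<-≤-trans (parent-shallower v≢root) (≤-pred d<fuel)))

  treeAdj-connected : ∀ u v → Walk treeAdj u v
  treeAdj-connected u v = walk-to-root u ++ʷ reverseʷ treeAdj-sym (walk-to-root v)

  tree-edge-upwards : ∀ {u v} → treeAdj u v ≡ true → depth v ≤ depth u → parent u ≡ v
  tree-edge-upwards {u} {v} e d≤ with witness (treeEdge? u v) e
  ... | inj₁ (_ , pu≡v) = pu≡v
  ... | inj₂ c          = ⊥-elim (<-irrefl refl (<-≤-trans (child-deeper c) d≤))

  -- The deepest vertex of a cycle would have both of its cycle neighbours as parent.
  treeAdj-acyclic : ¬ Cycle treeAdj
  treeAdj-acyclic (m , c , c-injective , consecutive , closing) with argmax (depth ∘ c)
  ... | i , deepest with cycle-neighbours treeAdj-sym c consecutive closing i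
  ...   | a , b , a≢b , ia , ib =
    a≢b (c-injective (trans (sym (tree-edge-upwards ia (deepest a))) (tree-edge-upwards ib (deepest b))))

  spanningTree : SubTree G
  spanningTree = record
    { V = ⊤ ; E = treeAdj ; E-sym = treeAdj-sym ; E-irr = treeAdj-irrefl ; E-sub = treeAdj⇒adj
    ; E-inV = λ _ _ _ → ∈⊤ ; conn = λ u v _ _ → treeAdj-connected u v ; acyclic = treeAdj-acyclic }

  module _ {m} (colour : Fin n → Fin m) where

    childColour : Fin n → Fin n → Fin m
    childColour u v with childOf? u v | childOf? v u
    ... | yes _ | _     = colour u
    ... | no _  | yes _ = colour v
    ... | no _  | no _  = colour root

    childColour-sym : ∀ u v → childColour u v ≡ childColour v u
    childColour-sym u v with childOf? u v | childOf? v u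
    ... | yes uv | yes vu = ⊥-elim (<-irrefl refl (<-trans (child-deeper uv) (child-deeper vu)))
    ... | yes _  | no _   = refl
    ... | no _   | yes _  = refl
    ... | no _   | no _   = refl

    childColour-up : ∀ {u v} → ChildOf u v → childColour u v ≡ colour u
    childColour-up {u} {v} c with childOf? u v
    ... | yes _  = refl
    ... | no ¬c = ⊥-elim (¬c c)

    childColour-down : ∀ {u v} → ChildOf v u → childColour u v ≡ colour v
    childColour-down {u} {v} c = trans (childColour-sym u v) (childColour-up c)

    childColouring : Colouring G m
    childColouring = record { col = childColour ; col-sym = childColour-sym }

    -- Together with its instance at y x: equally coloured vertices have disjoint parent edges.
    SeparatesParentEdges : Set
    SeparatesParentEdges = ∀ {x y} → x ≢ root → y ≢ root → x ≢ y → colour x ≡ colour y →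
      x ≢ parent y × parent x ≢ parent y

    up-down-colours-differ : SeparatesParentEdges → ∀ {u x y} → ChildOf u x → ChildOf y u →
      childColour u x ≢ childColour u y
    up-down-colours-differ separated cu cy same =
      proj₁ (separated (proj₁ cu) (proj₁ cy) (child≢parent cy ∘ sym)
                       (trans (sym (childColour-up cu)) (trans same (childColour-down cy))))
            (sym (proj₂ cy))

    childColouring-proper : SeparatesParentEdges → ProperTree childColouring spanningTree
    childColouring-proper separated u v w uv uw v≢w same
      with witness (treeEdge? u v) uv | witness (treeEdge? u w) uw
    ... | inj₁ (_ , pu≡v) | inj₁ (_ , pu≡w) = v≢w (trans (sym pu≡v) pu≡w)
    ... | inj₁ cu        | inj₂ cw        = up-down-colours-differ separated cu cw same
    ... | inj₂ cv        | inj₁ cu        = up-down-colours-differ separated cu cv (sym same)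
    ... | inj₂ cv        | inj₂ cw        =
      proj₂ (separated (proj₁ cv) (proj₁ cw) v≢w
                       (trans (sym (childColour-down cv)) (trans same (childColour-down cw))))
            (trans (proj₂ cv) (sym (proj₂ cw)))

    childColouring-kproper : SeparatesParentEdges → ∀ k → KProper k childColouring
    childColouring-kproper separated k S _ = spanningTree , (λ _ → ∈⊤) , childColouring-proper separated

adj⇒≢ : ∀ {n} (G : Graph n) {u v} → adj G u v ≡ true → u ≢ v
adj⇒≢ G {u} uv refl = contradiction (trans (sym uv) (irrefl G u)) λ ()

adj-flip : ∀ {n} (G : Graph n) {u v} → adj G u v ≡ true → adj G v u ≡ true
adj-flip G {u} {v} uv = trans (adj-sym G v u) uv

record StarAt {n} (G : Graph n) (c : Fin n) : Set where
  field
    centre-adjacent    : ∀ {v} → v ≢ c → adj G c v ≡ true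
    leaves-nonadjacent : ∀ {u v} → u ≢ c → v ≢ c → adj G u v ≡ false

module _ {n} {G : Graph n} {c} (star : StarAt G c) where
  open StarAt star

  leaf-neighbour : ∀ {u v} → u ≢ c → adj G u v ≡ true → v ≡ c
  leaf-neighbour u≢c uv = decidable-stable (_ ≟ c) λ v≢c →
    contradiction (trans (sym uv) (leaves-nonadjacent u≢c v≢c)) λ ()

  leaf-tree-edge : ∀ (T : SubTree G) {x y} → x ≢ c → x ≢ y → x ∈ V T → y ∈ V T → E T c x ≡ true
  leaf-tree-edge T x≢c x≢y x∈T y∈T with walk-first-step x≢y (conn T _ _ x∈T y∈T)
  ... | w , xw with leaf-neighbour x≢c (E-sub T _ _ xw)
  ...   | refl = trans (E-sym T _ _) xw

-- By pigeonhole two leaf edges share a colour, and a tree through both leaves contains both.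
star-not-kproper : ∀ {n} {G : Graph (suc n)} {c} → StarAt G c → ∀ {k} → 2 ≤ k → k ≤ suc n →
  ∀ {q} → q < n → (χ : Colouring G q) → ¬ KProper k χ
star-not-kproper {c = c} star 2≤k k≤n q<n χ kproper
  with pigeonhole q<n (λ i → col χ c (punchIn c i))
... | i , j , i<j , same with pair-in-subset-of-size (punchIn c i) (punchIn c j) 2≤k k≤n
...   | S , size , x∈S , y∈S with kproper S size
...     | T , S⊆T , proper =
  proper c (punchIn c i) (punchIn c j)
         (leaf-tree-edge star T (punchInᵢ≢i c i) x≢y (S⊆T x∈S) (S⊆T y∈S))
         (leaf-tree-edge star T (punchInᵢ≢i c j) (x≢y ∘ sym) (S⊆T y∈S) (S⊆T x∈S))
         x≢y same
  where
  x≢y : punchIn c i ≢ punchIn c j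
  x≢y = <⇒≢ i<j ∘ punchIn-injective c i j

module _ {k} {G : Graph (suc (suc k))} {c} (star : StarAt G c) where
  open StarAt star

  starTree : ParentTree G
  starTree = record
    { root = c ; parent = λ _ → c ; depth = depth
    ; parent-shallower = shallower ; parent-adjacent = λ v≢c → adj-flip G (centre-adjacent v≢c) }
    where
    depth : Fin (suc (suc k)) → ℕ
    depth v = if does (v ≟ c) then 0 else 1
    shallower : ∀ {v} → v ≢ c → depth c < depth v
    shallower {v} v≢c rewrite dec-true (c ≟ c) refl | dec-false (v ≟ c) v≢c = s≤s z≤n

  star-px : ∀ {j} → 2 ≤ j → j ≤ suc (suc k) → PxIs G j (suc k)
  star-px {j} 2≤j j≤n =
    (childColouring starTree (withoutRoot c) , childColouring-kproper starTree (withoutRoot c) separated j) ,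
    λ q q<n χ → star-not-kproper star 2≤j j≤n q<n χ
    where
    separated : SeparatesParentEdges starTree (withoutRoot c)
    separated x≢c y≢c x≢y same = ⊥-elim (x≢y (withoutRoot-injective x≢c y≢c same))

starAdj-sym : ∀ {n} (u v : Fin n) → starAdj u v ≡ starAdj v u
starAdj-sym zero    zero    = refl
starAdj-sym zero    (suc _) = refl
starAdj-sym (suc _) zero    = refl
starAdj-sym (suc _) (suc _) = refl

starAdj-centre : ∀ {n} {v : Fin (suc n)} → v ≢ zero → starAdj zero v ≡ true
starAdj-centre {v = zero}  v≢0 = ⊥-elim (v≢0 refl)
starAdj-centre {v = suc _} _   = refl

starAdj-leaves : ∀ {n} {u v : Fin (suc n)} → u ≢ zero → v ≢ zero → starAdj u v ≡ false
starAdj-leaves {u = zero}              u≢0 _   = ⊥-elim (u≢0 refl)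
starAdj-leaves {u = suc _} {v = zero}  _   v≢0 = ⊥-elim (v≢0 refl)
starAdj-leaves {u = suc _} {v = suc _} _   _   = refl

module _ {n} {G : Graph (suc n)} (f : Fin (suc n) ↔ Fin (suc n)) {c} (c↦0 : Inverse.to f c ≡ zero) where
  open Inverse f
  open StarAt

  leaf↦nonzero : ∀ {v} → v ≢ c → to v ≢ zero
  leaf↦nonzero {v} v≢c v↦0 =
    v≢c (trans (sym (strictlyInverseʳ v)) (trans (cong from (trans v↦0 (sym c↦0))) (strictlyInverseʳ c)))

  relabelled-star⇒star : (∀ u v → adj G u v ≡ starAdj (to u) (to v)) → StarAt G c
  relabelled-star⇒star relabel .centre-adjacent {v} v≢c =
    trans (relabel c v) (subst (λ z → starAdj z (to v) ≡ true) (sym c↦0) (starAdj-centre (leaf↦nonzero v≢c)))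
  relabelled-star⇒star relabel .leaves-nonadjacent {u} {v} u≢c v≢c =
    trans (relabel u v) (starAdj-leaves (leaf↦nonzero u≢c) (leaf↦nonzero v≢c))

  star⇒relabelled-star : StarAt G c → ∀ u v → adj G u v ≡ starAdj (to u) (to v)
  star⇒relabelled-star star u v with u ≟ c | v ≟ c
  ... | yes refl | yes refl rewrite c↦0 = irrefl G c
  ... | yes refl | no v≢c   rewrite c↦0 =
    trans (centre-adjacent star v≢c) (sym (starAdj-centre (leaf↦nonzero v≢c)))
  ... | no u≢c   | yes refl rewrite c↦0 =
    trans (adj-sym G u c) (trans (centre-adjacent star u≢c)
      (trans (sym (starAdj-centre (leaf↦nonzero u≢c))) (starAdj-sym zero (to u))))
  ... | no u≢c   | no v≢c   =
    trans (leaves-nonadjacent star u≢c v≢c) (sym (starAdj-leaves (leaf↦nonzero u≢c) (leaf↦nonzero v≢c)))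

isoToStar⇔star : ∀ {n} {G : Graph (suc n)} → IsoToStar G ⇔ ∃ (StarAt G)
isoToStar⇔star = mk⇔
  (λ (f , relabel) → Inverse.from f zero , relabelled-star⇒star f (Inverse.strictlyInverseˡ f zero) relabel)
  (λ (c , star) → transpose c zero , star⇒relabelled-star (transpose c zero) (transpose-sends c) star)
  where
  transpose-sends : ∀ {n} (c : Fin (suc n)) → PC.transpose c zero c ≡ zero
  transpose-sends c rewrite dec-true (c ≟ c) refl = refl

record Path₄ {n} (G : Graph n) : Set where
  field
    vertex           : Fin 4 → Fin n
    vertex-injective : Injective _≡_ _≡_ vertex
    edge             : ∀ (i : Fin 3) → adj G (vertex (inject₁ i)) (vertex (suc i)) ≡ true

  vertex-distinct : ∀ {i j} → i ≢ j → vertex i ≢ vertex j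
  vertex-distinct i≢j = i≢j ∘ vertex-injective

path₄ : ∀ {n} {G : Graph n} {a b c d} → adj G a b ≡ true → adj G b c ≡ true → adj G c d ≡ true →
  a ≢ c → b ≢ d → a ≢ d → Path₄ G
path₄ {G = G} {a} {b} {c} {d} ab bc cd a≢c b≢d a≢d =
  record { vertex = vertex ; vertex-injective = injective ; edge = edge }
  where
  vertex : Fin 4 → Fin _
  vertex 0F = a
  vertex 1F = b
  vertex 2F = c
  vertex 3F = d
  a≢b : a ≢ b
  a≢b = adj⇒≢ G ab
  b≢c : b ≢ c
  b≢c = adj⇒≢ G bc
  c≢d : c ≢ d
  c≢d = adj⇒≢ G cd
  injective : Injective _≡_ _≡_ vertex
  injective {0F} {0F} _ = refl
  injective {1F} {1F} _ = refl
  injective {2F} {2F} _ = refl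
  injective {3F} {3F} _ = refl
  injective {0F} {1F} e = ⊥-elim (a≢b e)
  injective {0F} {2F} e = ⊥-elim (a≢c e)
  injective {0F} {3F} e = ⊥-elim (a≢d e)
  injective {1F} {2F} e = ⊥-elim (b≢c e)
  injective {1F} {3F} e = ⊥-elim (b≢d e)
  injective {2F} {3F} e = ⊥-elim (c≢d e)
  injective {1F} {0F} e = ⊥-elim (a≢b (sym e))
  injective {2F} {0F} e = ⊥-elim (a≢c (sym e))
  injective {3F} {0F} e = ⊥-elim (a≢d (sym e))
  injective {2F} {1F} e = ⊥-elim (b≢c (sym e))
  injective {3F} {1F} e = ⊥-elim (b≢d (sym e))
  injective {3F} {2F} e = ⊥-elim (c≢d (sym e))
  edge : ∀ (i : Fin 3) → adj G (vertex (inject₁ i)) (vertex (suc i)) ≡ true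
  edge 0F = ab
  edge 1F = bc
  edge 2F = cd

-- Rooted at the second path vertex, the path hangs as on the path (up, level) and every
-- other vertex hangs from a neighbour closer to the path, below all path vertices.
module PathTree {n} {G : Graph n} (connected : Connected G) (P : Path₄ G) where
  open Path₄ P

  OnPath : Fin n → Set
  OnPath v = ∃ λ i → vertex i ≡ v

  onPath? : Decidable OnPath
  onPath? v = any? (λ i → vertex i ≟ v)

  open DistanceTo G connected onPath? (1F , refl) using (distance; closer-neighbour)

  up : Fin 4 → Fin 4
  up 0F = 1F
  up 1F = 1F
  up 2F = 1F
  up 3F = 2F

  level : Fin 4 → ℕ
  level 0F = 1
  level 1F = 0
  level 2F = 1
  level 3F = 2

  parent : Fin n → Fin n
  parent v with onPath? v
  ... | yes (i , _) = vertex (up i)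
  ... | no v∉P     = proj₁ (closer-neighbour v v∉P)

  depth : Fin n → ℕ
  depth v with onPath? v
  ... | yes (i , _) = level i
  ... | no _        = 3 + distance v

  onPath?-vertex : ∀ i → onPath? (vertex i) ≡ yes (i , refl)
  onPath?-vertex i with onPath? (vertex i)
  ... | no v∉P = ⊥-elim (v∉P (i , refl))
  ... | yes (j , e) with vertex-injective e
  ...   | refl with e
  ...     | refl = refl

  parent-vertex : ∀ i → parent (vertex i) ≡ vertex (up i)
  parent-vertex i rewrite onPath?-vertex i = refl

  depth-vertex : ∀ i → depth (vertex i) ≡ level i
  depth-vertex i rewrite onPath?-vertex i = refl

  up-shallower : ∀ i → i ≢ 1F → level (up i) < level i
  up-shallower 0F _   = s≤s z≤n
  up-shallower 1F i≢1 = ⊥-elim (i≢1 refl)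
  up-shallower 2F _   = s≤s z≤n
  up-shallower 3F _   = s≤s (s≤s z≤n)

  up-adjacent : ∀ i → i ≢ 1F → adj G (vertex i) (vertex (up i)) ≡ true
  up-adjacent 0F _   = edge 0F
  up-adjacent 1F i≢1 = ⊥-elim (i≢1 refl)
  up-adjacent 2F _   = adj-flip G (edge 1F)
  up-adjacent 3F _   = adj-flip G (edge 2F)

  level≤2 : ∀ i → level i ≤ 2
  level≤2 0F = s≤s z≤n
  level≤2 1F = z≤n
  level≤2 2F = s≤s z≤n
  level≤2 3F = s≤s (s≤s z≤n)

  depth≤3+distance : ∀ v → depth v ≤ 3 + distance v
  depth≤3+distance v with onPath? v
  ... | yes (i , _) = ≤-trans (level≤2 i) (m≤m+n 2 (suc (distance v)))
  ... | no _        = ≤-refl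

  parent-shallower : ∀ {v} → v ≢ vertex 1F → depth (parent v) < depth v
  parent-shallower {v} v≢root with onPath? v
  ... | yes (i , refl) =
    subst (_< level i) (sym (depth-vertex (up i))) (up-shallower i (v≢root ∘ cong vertex))
  ... | no v∉P with closer-neighbour v v∉P
  ...   | u , _ , closer = ≤-<-trans (depth≤3+distance u) (+-monoʳ-< 3 closer)

  parent-adjacent : ∀ {v} → v ≢ vertex 1F → adj G v (parent v) ≡ true
  parent-adjacent {v} v≢root with onPath? v
  ... | yes (i , refl) = up-adjacent i (v≢root ∘ cong vertex)
  ... | no v∉P         = proj₁ (proj₂ (closer-neighbour v v∉P))

  pathTree : ParentTree G
  pathTree = record
    { root = vertex 1F ; parent = parent ; depth = depth
    ; parent-shallower = parent-shallower ; parent-adjacent = parent-adjacent }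

  ends-separated : ∀ {i j} → i ≢ up j → up i ≢ up j →
    vertex i ≢ parent (vertex j) × parent (vertex i) ≢ parent (vertex j)
  ends-separated {i} {j} i≢↑j ↑i≢↑j rewrite parent-vertex i | parent-vertex j =
    vertex-distinct i≢↑j , vertex-distinct ↑i≢↑j

module _ {k} {G : Graph (suc (suc k))} (connected : Connected G) (P : Path₄ G) where
  open Path₄ P
  open PathTree connected P

  private
    root : Fin (suc (suc k))
    root = vertex 1F
    end₀≢root : vertex 0F ≢ root
    end₀≢root = vertex-distinct λ ()
    end₃≢root : vertex 3F ≢ root
    end₃≢root = vertex-distinct λ ()

  ends-differ : withoutRoot root (vertex 0F) ≢ withoutRoot root (vertex 3F)
  ends-differ = vertex-distinct (λ ()) ∘ withoutRoot-injective end₀≢root end₃≢root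

  pathColour : Fin (suc (suc k)) → Fin k
  pathColour = merge ends-differ ∘ withoutRoot root

  pathColour-separates : SeparatesParentEdges pathTree pathColour
  pathColour-separates {x} {y} x≢root y≢root x≢y same with merge-identifies ends-differ same
  ... | inj₁ eq = ⊥-elim (x≢y (withoutRoot-injective x≢root y≢root eq))
  ... | inj₂ (inj₁ (x↦₀ , y↦₃))
    with refl ← withoutRoot-injective x≢root end₀≢root x↦₀ | refl ← withoutRoot-injective y≢root end₃≢root y↦₃ =
    ends-separated (λ ()) (λ ())
  ... | inj₂ (inj₂ (x↦₃ , y↦₀))
    with refl ← withoutRoot-injective x≢root end₃≢root x↦₃ | refl ← withoutRoot-injective y≢root end₀≢root y↦₀ =
    ends-separated (λ ()) (λ ())

  path-kproper : ∀ j → KProper j (childColouring pathTree pathColour)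
  path-kproper = childColouring-kproper pathTree pathColour pathColour-separates

module _ {m} {G : Graph (4 + m)} (connected : Connected G) (no-path : ¬ Path₄ G) where

  -- Any vertex outside a triangle adjacent to it would start a path on four vertices,
  -- so the triangle would contain every vertex.
  module _ {a b c} (ab : adj G a b ≡ true) (bc : adj G b c ≡ true) (ca : adj G c a ≡ true) where

    OnTriangle : Fin (4 + m) → Set
    OnTriangle v = v ≡ a ⊎ v ≡ b ⊎ v ≡ c

    triangle-closed : ∀ {x y} → OnTriangle x → adj G x y ≡ true → OnTriangle y
    triangle-closed {x} {y} x∈T xy with y ≟ a | y ≟ b | y ≟ c
    ... | yes y≡a | _       | _       = inj₁ y≡a
    ... | _       | yes y≡b | _       = inj₂ (inj₁ y≡b)
    ... | _       | _       | yes y≡c = inj₂ (inj₂ y≡c)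
    ... | no y≢a  | no y≢b  | no y≢c  with x∈T
    ...   | inj₁ refl         = ⊥-elim (no-path (path₄ (adj-flip G xy) ab bc y≢b (adj⇒≢ G ca ∘ sym) y≢c))
    ...   | inj₂ (inj₁ refl) = ⊥-elim (no-path (path₄ (adj-flip G xy) bc ca y≢c (adj⇒≢ G ab ∘ sym) y≢a))
    ...   | inj₂ (inj₂ refl) = ⊥-elim (no-path (path₄ (adj-flip G xy) ca ab y≢a (adj⇒≢ G bc ∘ sym) y≢b))

    no-triangle : ⊥
    no-triangle with avoid-three (s≤s (s≤s (s≤s (s≤s z≤n)))) a b c
    ... | t , t≢a , t≢b , t≢c with walk-preserves OnTriangle triangle-closed (inj₁ refl) (connected a t)
    ...   | inj₁ t≡a         = t≢a t≡a
    ...   | inj₂ (inj₁ t≡b) = t≢b t≡b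
    ...   | inj₂ (inj₂ t≡c) = t≢c t≡c

  leaf⇒star : ∀ {c ℓ} → adj G c ℓ ≡ true → (∀ {v} → adj G ℓ v ≡ true → v ≡ c) → StarAt G c
  leaf⇒star {c} {ℓ} cℓ only-c =
    record { centre-adjacent = centre-adjacent ; leaves-nonadjacent = leaves-nonadjacent }
    where
    Near : Fin (4 + m) → Set
    Near v = v ≡ c ⊎ adj G c v ≡ true
    -- A vertex y beyond a neighbour x of c gives the path y x c ℓ.
    near-closed : ∀ {x y} → Near x → adj G x y ≡ true → Near y
    near-closed (inj₁ refl) xy = inj₂ xy
    near-closed {x} {y} (inj₂ cx) xy with y ≟ c | adj G c y ≟ᵇ true
    ... | yes y≡c | _      = inj₁ y≡c
    ... | no _    | yes cy = inj₂ cy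
    ... | no y≢c  | no _   with x ≟ ℓ | y ≟ ℓ
    ...   | yes refl | _        = ⊥-elim (y≢c (only-c xy))
    ...   | no _     | yes refl = ⊥-elim (adj⇒≢ G cx (sym (only-c (adj-flip G xy))))
    ...   | no x≢ℓ   | no y≢ℓ   = ⊥-elim (no-path (path₄ (adj-flip G xy) (adj-flip G cx) cℓ y≢c x≢ℓ y≢ℓ))
    centre-adjacent : ∀ {v} → v ≢ c → adj G c v ≡ true
    centre-adjacent {v} v≢c with walk-preserves Near near-closed (inj₁ refl) (connected c v)
    ... | inj₁ v≡c = ⊥-elim (v≢c v≡c)
    ... | inj₂ cv  = cv
    leaves-nonadjacent : ∀ {u v} → u ≢ c → v ≢ c → adj G u v ≡ false
    leaves-nonadjacent {u} {v} u≢c v≢c with adj G u v in uv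
    ... | false = refl
    ... | true  = ⊥-elim (no-triangle (centre-adjacent u≢c) uv (adj-flip G (centre-adjacent v≢c)))

  -- Take an edge 0 w. Unless 0 or w is a leaf, they have further neighbours y and z,
  -- which form either the triangle 0 w y or the path y 0 w z.
  p4-free⇒star : ∃ (StarAt G)
  p4-free⇒star with walk-first-step (λ ()) (connected 0F 1F)
  ... | w , 0w with any? (λ y → ¬? (y ≟ w) ×-dec (adj G 0F y ≟ᵇ true))
  ...   | no only-w =
    w , leaf⇒star (adj-flip G 0w) λ {v} 0v → decidable-stable (v ≟ w) λ v≢w → only-w (v , v≢w , 0v)
  ...   | yes (y , y≢w , 0y) with any? (λ z → ¬? (z ≟ 0F) ×-dec (adj G w z ≟ᵇ true))
  ...     | no only-0 =
    0F , leaf⇒star 0w λ {v} wv → decidable-stable (v ≟ 0F) λ v≢0 → only-0 (v , v≢0 , wv)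
  ...     | yes (z , z≢0 , wz) with y ≟ z
  ...       | yes refl = ⊥-elim (no-triangle 0w wz (adj-flip G 0y))
  ...       | no y≢z   = ⊥-elim (no-path (path₄ (adj-flip G 0y) 0w wz y≢w (z≢0 ∘ sym) y≢z))

theorem4p2 : (n : ℕ) → 4 ≤ n → (G : Graph n) → Connected G →
    (k : ℕ) → 3 ≤ k → k ≤ n →
    (PxIs G k (n ∸ 1) ⇔ IsoToStar G)
theorem4p2 .(4 + m) (s≤s (s≤s (s≤s (s≤s {n = m} _)))) G connected k 3≤k k≤n = mk⇔ px⇒star star⇒px
  where
  2≤k : 2 ≤ k
  2≤k = ≤-trans (n≤1+n 2) 3≤k

  px⇒star : PxIs G k (3 + m) → IsoToStar G
  px⇒star (_ , minimal) = Equivalence.from isoToStar⇔star (p4-free⇒star connected no-path)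
    where
    no-path : ¬ Path₄ G
    no-path P = minimal (2 + m) ≤-refl
      (childColouring (PathTree.pathTree connected P) (pathColour connected P)) (path-kproper connected P k)

  star⇒px : IsoToStar G → PxIs G k (3 + m)
  star⇒px iso = star-px (proj₂ (Equivalence.to isoToStar⇔star iso)) 2≤k k≤n
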